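{- Let $a\geq 3$ and $m\geq 2a^2-a+2$ be integers, let $C(m,a)=\left\lceil\frac{m-1}{a}\left\lceil\frac{m-1}{a}\right\rceil\right\rceil$, and write $m=ua^2+va+c$ with $u$ as large as possible and $0\leq v,c\leq a-1$ (integers). Then: (i) if $c=1$ then $C(m,a)=\frac{(m-1)^2}{a^2}$; (ii) if $c=0$ then $C(m,a)=\frac{m^2-m+va}{a^2}$; (iii) if $2\leq c\leq a-1$ then $C(m,a)=\frac{m^2+(a-c-1)m+c-ac-vac+va+ta^2}{a^2}$, where $t=\left\lceil\frac{(c-1)(v+1)}{a}\right\rceil$. -}

module Defs where

open import Data.Nat using (ℕ; _+_; _*_; _∸_; _/_; NonZero)

⌈_/_⌉ : ℕ → (a : ℕ) → .{{NonZero a}} → ℕ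
⌈ x / a ⌉ = (x + (a ∸ 1)) / a

-- C(m,a) = ⌈ (m-1)/a · ⌈ (m-1)/a ⌉ ⌉ = ⌈ (m-1)·⌈(m-1)/a⌉ / a ⌉
C : ℕ → (a : ℕ) → .{{NonZero a}} → ℕ
C m a = ⌈ (m ∸ 1) * ⌈ (m ∸ 1) / a ⌉ / a ⌉

module Submission where

-- Write q = u·a + v, so that m = q·a + c with 0 ≤ c < a.  Everything rests
-- on one characterisation of ceiling division: ⌈ N / a ⌉ = x as soon as
-- N + y = x·a with 0 ≤ y < a.  From it we get the shift rule
-- ⌈ (y + x·a) / a ⌉ = ⌈ y / a ⌉ + x and the unit rule ⌈ y / a ⌉ = 1 for
-- 1 ≤ y ≤ a, and these evaluate C(m,a) exactly in ℕ for each shape of c: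
--   c = 1      : m - 1 = q·a,           C = q²;
--   c = 1 + c' : m - 1 = c' + q·a,      C = ⌈ c'(v+1)/a ⌉ + c'·u + q(q+1);
--   c = 0      : m - 1 = (q-1)·a + a-1, C + u = q²  (here q ≥ 1 by the bound on m).
-- Finally each natural-number value is cast to ℤ, where the three claimed
-- closed forms become polynomial identities in u, v, a (and c', t),
-- discharged by the ring solver.

open import Defs
open import Data.Nat using (ℕ; _≤_; _<_; _*_; _+_; _∸_; NonZero)
open import Data.Integer using (ℤ; +_) renaming (_*_ to _*ℤ_; _+_ to _+ℤ_; _-_ to _-ℤ_)
open import Data.Product using (_×_)
open import Relation.Binary.PropositionalEquality using (_≡_)

open import Data.Nat using (suc; zero; _/_; s≤s; z≤n; >-nonZero⁻¹)
open import Data.Nat.Properties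
  using (+-assoc; +-comm; +-identityʳ; *-identityˡ; m≤n+m; n≤1+n; m∸n≤m; m+[n∸m]≡n;
         m≤n⇒∃[o]m+o≡n; m+1+n≰m; ≤-trans; <⇒≤)
open import Data.Nat.DivMod using (+-distrib-/-∣ʳ; m*n/n≡m; m<n⇒m/n≡0; /-congˡ)
open import Data.Nat.Divisibility using (n∣m*n)
open import Data.Integer.Properties using (pos-*)
open import Data.Product using (_,_)
open import Data.Empty using (⊥-elim)
open import Relation.Binary.PropositionalEquality using (refl; sym; trans; cong; cong₂; subst; module ≡-Reasoning)
import Data.Nat.Tactic.RingSolver as ℕ-Ring
import Data.Integer.Tactic.RingSolver as ℤ-Ring

open ≡-Reasoning

/-shift : ∀ {a} .{{_ : NonZero a}} y x → (y + x * a) / a ≡ y / a + x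
/-shift {a} y x = trans (+-distrib-/-∣ʳ y (n∣m*n x)) (cong (λ w → y / a + w) (m*n/n≡m x a))

⌈⌉-char : ∀ {a} .{{_ : NonZero a}} {N x y} → N + y ≡ x * a → y < a → ⌈ N / a ⌉ ≡ x
⌈⌉-char {suc k} {N} {x} {y} N+y≡xa (s≤s y≤k) with m≤n⇒∃[o]m+o≡n y≤k
... | d , refl = begin
  (N + (y + d)) / suc k  ≡⟨ /-congˡ (trans (sym (+-assoc N y d)) (trans (cong (_+ d) N+y≡xa) (+-comm (x * suc k) d))) ⟩
  (d + x * suc k) / suc k ≡⟨ /-shift d x ⟩
  d / suc k + x           ≡⟨ cong (_+ x) (m<n⇒m/n≡0 (s≤s (m≤n+m d y))) ⟩
  x                       ∎

⌈⌉-exact : ∀ {a} .{{_ : NonZero a}} x → ⌈ x * a / a ⌉ ≡ x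
⌈⌉-exact {a} x = ⌈⌉-char (+-identityʳ (x * a)) (>-nonZero⁻¹ a)

⌈⌉-unit : ∀ {a} .{{_ : NonZero a}} {y} → 1 ≤ y → y ≤ a → ⌈ y / a ⌉ ≡ 1
⌈⌉-unit {suc k} {suc j} _ y≤a =
  ⌈⌉-char (trans (m+[n∸m]≡n y≤a) (sym (*-identityˡ (suc k)))) (s≤s (m∸n≤m k j))

⌈⌉-shift : ∀ {a} .{{_ : NonZero a}} y x → ⌈ (y + x * a) / a ⌉ ≡ ⌈ y / a ⌉ + x
⌈⌉-shift {a} y x = trans (/-congˡ (swap y (x * a) (a ∸ 1))) (/-shift (y + (a ∸ 1)) x)
  where
  swap : ∀ p q r → p + q + r ≡ p + r + q
  swap = ℕ-Ring.solve-∀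

digits : ∀ u v a c → u * (a * a) + v * a + c ≡ c + (u * a + v) * a
digits = ℕ-Ring.solve-∀

C-one : ∀ {a} .{{_ : NonZero a}} q → C (1 + q * a) a ≡ q * q
C-one {a} q = begin
  ⌈ q * a * ⌈ q * a / a ⌉ / a ⌉ ≡⟨ cong (λ w → ⌈ q * a * w / a ⌉) (⌈⌉-exact q) ⟩
  ⌈ q * a * q / a ⌉             ≡⟨ cong (λ n → ⌈ n / a ⌉) (regroup q a) ⟩
  ⌈ q * q * a / a ⌉             ≡⟨ ⌈⌉-exact (q * q) ⟩
  q * q                         ∎
  where
  regroup : ∀ q a → q * a * q ≡ q * q * a
  regroup = ℕ-Ring.solve-∀

C-mid : ∀ {a} .{{_ : NonZero a}} {c'} q → 1 ≤ c' → c' ≤ a →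
        C (suc c' + q * a) a ≡ ⌈ c' * suc q / a ⌉ + q * suc q
C-mid {a} {c'} q 1≤c' c'≤a = begin
  ⌈ (c' + q * a) * ⌈ (c' + q * a) / a ⌉ / a ⌉ ≡⟨ cong (λ w → ⌈ (c' + q * a) * w / a ⌉) inner ⟩
  ⌈ (c' + q * a) * suc q / a ⌉                ≡⟨ cong (λ n → ⌈ n / a ⌉) (expand c' q a) ⟩
  ⌈ (c' * suc q + q * suc q * a) / a ⌉        ≡⟨ ⌈⌉-shift (c' * suc q) (q * suc q) ⟩
  ⌈ c' * suc q / a ⌉ + q * suc q              ∎
  where
  inner : ⌈ (c' + q * a) / a ⌉ ≡ suc q
  inner = trans (⌈⌉-shift c' q) (cong (_+ q) (⌈⌉-unit 1≤c' c'≤a))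
  expand : ∀ c' q a → (c' + q * a) * suc q ≡ c' * suc q + q * suc q * a
  expand = ℕ-Ring.solve-∀

⌈⌉-mid-term : ∀ {a} .{{_ : NonZero a}} c' u v →
              ⌈ c' * suc (u * a + v) / a ⌉ ≡ ⌈ c' * (v + 1) / a ⌉ + c' * u
⌈⌉-mid-term {a} c' u v = trans (cong (λ n → ⌈ n / a ⌉) (split c' u v a)) (⌈⌉-shift (c' * (v + 1)) (c' * u))
  where
  split : ∀ c' u v a → c' * suc (u * a + v) ≡ c' * (v + 1) + c' * u * a
  split = ℕ-Ring.solve-∀

C-zero : ∀ {a u v q} .{{_ : NonZero a}} → 2 ≤ a → 1 ≤ q → u * a + v ≡ q → v < a →
         C (q * a) a + u ≡ q * q
C-zero {suc k} {u} {v} {suc p} (s≤s 1≤k) (s≤s z≤n) ua+v≡q v<a = begin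
  ⌈ n * ⌈ n / a ⌉ / a ⌉ + u ≡⟨ cong (λ w → ⌈ n * w / a ⌉ + u) inner ⟩
  ⌈ n * q / a ⌉ + u         ≡⟨ ⌈⌉-shift (n * q) u ⟨
  ⌈ (n * q + u * a) / a ⌉   ≡⟨ ⌈⌉-char short v<a ⟩
  q * q                     ∎
  where
  a = suc k
  q = suc p
  -- q·a - 1, which is definitionally (a - 1) + (q - 1)·a
  n = k + p * a
  inner : ⌈ n / a ⌉ ≡ q
  inner = trans (⌈⌉-shift k p) (cong (_+ p) (⌈⌉-unit 1≤k (n≤1+n k)))
  square : ∀ k p → (k + p * suc k) * suc p + suc p ≡ suc p * suc p * suc k
  square = ℕ-Ring.solve-∀
  short : n * q + u * a + v ≡ q * q * a
  short = begin
    n * q + u * a + v   ≡⟨ +-assoc (n * q) (u * a) v ⟩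
    n * q + (u * a + v) ≡⟨ cong (λ w → n * q + w) ua+v≡q ⟩
    n * q + q           ≡⟨ square k p ⟩
    q * q * a           ∎

positive-quotient : ∀ a u v → 2 * (a * a) + 2 ≤ u * (a * a) + v * a + 0 + a → 1 ≤ u * a + v
positive-quotient a u v bound = positive a (u * a + v) (subst (λ n → 2 * (a * a) + 2 ≤ n + a) (digits u v a 0) bound)
  where
  excess : ∀ b → 2 * (suc b * suc b) + 2 ≡ suc b + suc (2 * (b * b) + 3 * b + 2)
  excess = ℕ-Ring.solve-∀
  positive : ∀ a q → 2 * (a * a) + 2 ≤ q * a + a → 1 ≤ q
  positive zero    zero    ()
  positive (suc b) zero    bound = ⊥-elim (m+1+n≰m (suc b) (subst (_≤ suc b) (excess b) bound))
  positive _       (suc q) _     = s≤s z≤n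

cast-digits : ∀ u v a c → + (u * (a * a) + v * a + c) ≡ + u *ℤ (+ a *ℤ + a) +ℤ + v *ℤ + a +ℤ + c
cast-digits u v a c =
  cong₂ (λ x y → x +ℤ y +ℤ + c) (trans (pos-* u (a * a)) (cong (+ u *ℤ_) (pos-* a a))) (pos-* v a)

cast-quotient : ∀ u v a → + (u * a + v) ≡ + u *ℤ + a +ℤ + v
cast-quotient u v a = cong (_+ℤ + v) (pos-* u a)

cast-difference : ∀ {x y z} → x + y ≡ z → + x ≡ + z -ℤ + y
cast-difference {x} {y} refl = sym (cancel (+ x) (+ y))
  where
  cancel : ∀ X Y → X +ℤ Y -ℤ Y ≡ X
  cancel = ℤ-Ring.solve-∀

closed-form-i : ∀ {a} .{{_ : NonZero a}} u v → let m = u * (a * a) + v * a + 1 in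
                + (C m a) *ℤ + (a * a) ≡ (+ m -ℤ + 1) *ℤ (+ m -ℤ + 1)
closed-form-i {a} u v = begin
  + C m a *ℤ + (a * a)          ≡⟨ cong (λ n → + n *ℤ + (a * a)) C≡q² ⟩
  + (q * q) *ℤ + (a * a)        ≡⟨ cong₂ _*ℤ_ (pos-* q q) (pos-* a a) ⟩
  + q *ℤ + q *ℤ (A *ℤ A)        ≡⟨ cong (λ Q → Q *ℤ Q *ℤ (A *ℤ A)) (cast-quotient u v a) ⟩
  (U *ℤ A +ℤ V) *ℤ (U *ℤ A +ℤ V) *ℤ (A *ℤ A)
                                ≡⟨ identity U V A ⟩
  (M -ℤ + 1) *ℤ (M -ℤ + 1)      ≡⟨ cong (λ M → (M -ℤ + 1) *ℤ (M -ℤ + 1)) (cast-digits u v a 1) ⟨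
  (+ m -ℤ + 1) *ℤ (+ m -ℤ + 1)  ∎
  where
  m = u * (a * a) + v * a + 1
  q = u * a + v
  U = + u ; V = + v ; A = + a
  M = U *ℤ (A *ℤ A) +ℤ V *ℤ A +ℤ + 1
  C≡q² : C m a ≡ q * q
  C≡q² = trans (cong (λ n → C n a) (digits u v a 1)) (C-one q)
  identity : ∀ U V A → (U *ℤ A +ℤ V) *ℤ (U *ℤ A +ℤ V) *ℤ (A *ℤ A)
             ≡ (U *ℤ (A *ℤ A) +ℤ V *ℤ A +ℤ + 1 -ℤ + 1) *ℤ (U *ℤ (A *ℤ A) +ℤ V *ℤ A +ℤ + 1 -ℤ + 1)
  identity = ℤ-Ring.solve-∀

closed-form-ii : ∀ {a} .{{_ : NonZero a}} u v → 2 ≤ a → v < a → 1 ≤ u * a + v →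
                 let m = u * (a * a) + v * a + 0 in
                 + (C m a) *ℤ + (a * a) ≡ (+ m) *ℤ (+ m) -ℤ (+ m) +ℤ (+ v) *ℤ (+ a)
closed-form-ii {a} u v 2≤a v<a 1≤q = begin
  + C m a *ℤ + (a * a)               ≡⟨ cong (_*ℤ + (a * a)) (cast-difference {C m a} {u} C+u≡q²) ⟩
  (+ (q * q) -ℤ U) *ℤ + (a * a)      ≡⟨ cong₂ (λ S A² → (S -ℤ U) *ℤ A²) (pos-* q q) (pos-* a a) ⟩
  (+ q *ℤ + q -ℤ U) *ℤ (A *ℤ A)      ≡⟨ cong (λ Q → (Q *ℤ Q -ℤ U) *ℤ (A *ℤ A)) (cast-quotient u v a) ⟩
  ((U *ℤ A +ℤ V) *ℤ (U *ℤ A +ℤ V) -ℤ U) *ℤ (A *ℤ A)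
                                     ≡⟨ identity U V A ⟩
  M *ℤ M -ℤ M +ℤ V *ℤ A              ≡⟨ cong (λ M → M *ℤ M -ℤ M +ℤ V *ℤ A) (cast-digits u v a 0) ⟨
  + m *ℤ + m -ℤ + m +ℤ V *ℤ A        ∎
  where
  m = u * (a * a) + v * a + 0
  q = u * a + v
  U = + u ; V = + v ; A = + a
  M = U *ℤ (A *ℤ A) +ℤ V *ℤ A +ℤ + 0
  C+u≡q² : C m a + u ≡ q * q
  C+u≡q² = trans (cong (λ n → C n a + u) (digits u v a 0)) (C-zero 2≤a 1≤q refl v<a)
  identity : ∀ U V A → ((U *ℤ A +ℤ V) *ℤ (U *ℤ A +ℤ V) -ℤ U) *ℤ (A *ℤ A)
             ≡ (U *ℤ (A *ℤ A) +ℤ V *ℤ A +ℤ + 0) *ℤ (U *ℤ (A *ℤ A) +ℤ V *ℤ A +ℤ + 0)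
               -ℤ (U *ℤ (A *ℤ A) +ℤ V *ℤ A +ℤ + 0) +ℤ V *ℤ A
  identity = ℤ-Ring.solve-∀

closed-form-iii : ∀ {a} .{{_ : NonZero a}} u v c → 2 ≤ c → c < a →
                  let m = u * (a * a) + v * a + c ; t = ⌈ (c ∸ 1) * (v + 1) / a ⌉ in
                  + (C m a) *ℤ + (a * a)
                  ≡ (+ m) *ℤ (+ m) +ℤ (+ a -ℤ + c -ℤ + 1) *ℤ (+ m) +ℤ (+ c) -ℤ (+ a) *ℤ (+ c)
                    -ℤ (+ v) *ℤ (+ a) *ℤ (+ c) +ℤ (+ v) *ℤ (+ a) +ℤ (+ t) *ℤ (+ a) *ℤ (+ a)
closed-form-iii {a} u v (suc c') (s≤s 1≤c') c<a = begin
  + C m a *ℤ + (a * a)                          ≡⟨ cong (λ n → + n *ℤ + (a * a)) C≡value ⟩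
  + (t + c' * u + q * suc q) *ℤ + (a * a)
      ≡⟨ cong₂ _*ℤ_ (cong₂ (λ X Y → T +ℤ X +ℤ Y) (pos-* c' u) (pos-* q (suc q))) (pos-* a a) ⟩
  (T +ℤ C' *ℤ U +ℤ + q *ℤ (+ 1 +ℤ + q)) *ℤ (A *ℤ A)
      ≡⟨ cong (λ Q → (T +ℤ C' *ℤ U +ℤ Q *ℤ (+ 1 +ℤ Q)) *ℤ (A *ℤ A)) (cast-quotient u v a) ⟩
  (T +ℤ C' *ℤ U +ℤ (U *ℤ A +ℤ V) *ℤ (+ 1 +ℤ (U *ℤ A +ℤ V))) *ℤ (A *ℤ A)
      ≡⟨ identity U V A C' T ⟩
  M *ℤ M +ℤ (A -ℤ Cc -ℤ + 1) *ℤ M +ℤ Cc -ℤ A *ℤ Cc -ℤ V *ℤ A *ℤ Cc +ℤ V *ℤ A +ℤ T *ℤ A *ℤ A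
      ≡⟨ cong (λ M → M *ℤ M +ℤ (A -ℤ Cc -ℤ + 1) *ℤ M +ℤ Cc -ℤ A *ℤ Cc -ℤ V *ℤ A *ℤ Cc
                       +ℤ V *ℤ A +ℤ T *ℤ A *ℤ A) (cast-digits u v a (suc c')) ⟨
  + m *ℤ + m +ℤ (A -ℤ Cc -ℤ + 1) *ℤ + m +ℤ Cc -ℤ A *ℤ Cc -ℤ V *ℤ A *ℤ Cc +ℤ V *ℤ A +ℤ T *ℤ A *ℤ A
      ∎
  where
  m = u * (a * a) + v * a + suc c'
  q = u * a + v
  t = ⌈ c' * (v + 1) / a ⌉
  U = + u ; V = + v ; A = + a ; C' = + c' ; T = + t
  Cc = + 1 +ℤ C'
  M = U *ℤ (A *ℤ A) +ℤ V *ℤ A +ℤ Cc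
  C≡value : C m a ≡ t + c' * u + q * suc q
  C≡value = begin
    C m a                               ≡⟨ cong (λ n → C n a) (digits u v a (suc c')) ⟩
    C (suc c' + q * a) a                ≡⟨ C-mid q 1≤c' (≤-trans (n≤1+n c') (<⇒≤ c<a)) ⟩
    ⌈ c' * suc q / a ⌉ + q * suc q      ≡⟨ cong (_+ q * suc q) (⌈⌉-mid-term c' u v) ⟩
    t + c' * u + q * suc q              ∎
  identity : ∀ U V A C' T →
             (T +ℤ C' *ℤ U +ℤ (U *ℤ A +ℤ V) *ℤ (+ 1 +ℤ (U *ℤ A +ℤ V))) *ℤ (A *ℤ A)
             ≡ (U *ℤ (A *ℤ A) +ℤ V *ℤ A +ℤ (+ 1 +ℤ C')) *ℤ (U *ℤ (A *ℤ A) +ℤ V *ℤ A +ℤ (+ 1 +ℤ C'))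
               +ℤ (A -ℤ (+ 1 +ℤ C') -ℤ + 1) *ℤ (U *ℤ (A *ℤ A) +ℤ V *ℤ A +ℤ (+ 1 +ℤ C'))
               +ℤ (+ 1 +ℤ C') -ℤ A *ℤ (+ 1 +ℤ C') -ℤ V *ℤ A *ℤ (+ 1 +ℤ C') +ℤ V *ℤ A +ℤ T *ℤ A *ℤ A
  identity = ℤ-Ring.solve-∀

-- Lemma 10: each part is one of the closed forms; a ≥ 3 and the bound on m
-- are only needed for part (ii), to get a ≥ 2 and q ≥ 1.
lemma10 : (a m : ℕ) → .{{_ : NonZero a}} → 3 ≤ a → 2 * (a * a) + 2 ≤ m + a →
    (u v c : ℕ) → m ≡ u * (a * a) + v * a + c → v < a → c < a →
    ((c ≡ 1 → (+ (C m a)) *ℤ (+ (a * a)) ≡ (+ m -ℤ + 1) *ℤ (+ m -ℤ + 1))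
    × (c ≡ 0 → (+ (C m a)) *ℤ (+ (a * a)) ≡ (+ m) *ℤ (+ m) -ℤ (+ m) +ℤ (+ v) *ℤ (+ a))
    × (2 ≤ c → (+ (C m a)) *ℤ (+ (a * a))
    ≡ (+ m) *ℤ (+ m) +ℤ (+ a -ℤ + c -ℤ + 1) *ℤ (+ m) +ℤ (+ c) -ℤ (+ a) *ℤ (+ c)
    -ℤ (+ v) *ℤ (+ a) *ℤ (+ c) +ℤ (+ v) *ℤ (+ a)
    +ℤ (+ ⌈ (c ∸ 1) * (v + 1) / a ⌉) *ℤ (+ a) *ℤ (+ a)))
lemma10 a _ 3≤a bound u v c refl v<a c<a =
    (λ { refl → closed-form-i u v })
  , (λ { refl → closed-form-ii u v 2≤a v<a (positive-quotient a u v bound) })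
  , (λ 2≤c → closed-form-iii u v c 2≤c c<a)
  where
  2≤a : 2 ≤ a
  2≤a = ≤-trans (n≤1+n 2) 3≤a
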